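{- There is no regular total ordering $<$ of $Sen(L)$ such that, with $f=\min_<$, every structure $\langle M,f\rangle$ ($M$ a truth assignment) satisfies all instances of the scheme $$(*)\qquad \varphi|(\psi\wedge\sigma)\leftrightarrow(\varphi|\psi)\wedge(\varphi|\sigma).$$ Consequently there is no nonempty $X\subseteq Reg^*$ such that $(*)$ is a $\models_X$-tautology. Similarly for the dual scheme $$(**)\qquad \varphi|(\psi\vee\sigma)\leftrightarrow(\varphi|\psi)\vee(\varphi|\sigma):$$ there is no regular total ordering $<$ with $f=\min_<$ such that every $\langle M,f\rangle$ satisfies $(**)$, and no nonempty $X\subseteq Reg^*$ such that $(**)$ is a $\models_X$-tautology.
   Context: $L$ is the propositional language with atoms $p_0,p_1,\ldots$ and connectives $\neg,\wedge$ (others defined); $L_s$ adds a primitive binary connective $|$. $\sim$ is classical equivalence on $Sen(L)$, $[\alpha]=\{\beta:\beta\sim\alpha\}$. A total ordering $<$ of $Sen(L)$ is regular if $\alpha\not\sim\beta$ and $\alpha<\beta$ imply $\alpha'<\beta'$ for all $\alpha'\in[\alpha],\beta'\in[\beta]$. A choice function for $L$ is a map $f$ with $f(\alpha,\beta)=f(\{\alpha,\beta\})\in\{\alpha,\beta\}$; $Reg^*$ is the set of choice functions $\min_<$ for regular total orderings $<$ of $Sen(L)$. Each $f$ induces $\overline f:Sen(L_s)\to Sen(L)$: identity on $Sen(L)$, commuting with $\neg,\wedge$, and $\overline f(\varphi|\psi)=f(\overline f(\varphi),\overline f(\psi))$. For a truth assignment $M$, $\langle M,f\rangle\models_s\varphi$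 iff $M\models\overline f(\varphi)$. A scheme is a $\models_X$-tautology if every instance (with $\varphi,\psi,\sigma\in Sen(L_s)$) holds in every $\langle M,f\rangle$ with $f\in X$. -}

module Defs where

open import Data.Nat using (ℕ)
open import Data.Bool using (Bool; true; false; not; _∧_)
open import Data.Product using (Σ; ∃; _×_; _,_)
open import Data.Sum using (_⊎_)
open import Relation.Nullary using (¬_)
open import Relation.Binary.PropositionalEquality using (_≡_)
open import Relation.Binary.Structures using (IsStrictTotalOrder)
open import Relation.Binary.Definitions using (tri<; tri≈; tri>)

data Sen : Set where
  atom : ℕ → Sen
  neg  : Sen → Sen
  conj : Sen → Sen → Sen

data SenS : Set where
  atom : ℕ → SenS
  neg  : SenS → SenS
  conj : SenS → SenS → SenS
  bar  : SenS → SenS → SenS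

disj : SenS → SenS → SenS
disj φ ψ = neg (conj (neg φ) (neg ψ))

iff : SenS → SenS → SenS
iff φ ψ = conj (neg (conj φ (neg ψ))) (neg (conj ψ (neg φ)))

Assignment : Set
Assignment = ℕ → Bool

eval : Assignment → Sen → Bool
eval M (atom n)   = M n
eval M (neg α)    = not (eval M α)
eval M (conj α β) = eval M α ∧ eval M β

_⊨_ : Assignment → Sen → Set
M ⊨ α = eval M α ≡ true

_∼_ : Sen → Sen → Set
α ∼ β = ∀ (M : Assignment) → eval M α ≡ eval M β

TotalOrdering : (Sen → Sen → Set) → Set
TotalOrdering _<_ = IsStrictTotalOrder _≡_ _<_

Regular : (Sen → Sen → Set) → Set
Regular _<_ = ∀ α β α' β' → ¬ (α ∼ β) → α < β → α ∼ α' → β ∼ β' → α' < β'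

minOf : {_<_ : Sen → Sen → Set} → TotalOrdering _<_ → Sen → Sen → Sen
minOf sto α β with IsStrictTotalOrder.compare sto α β
... | tri< _ _ _ = α
... | tri≈ _ _ _ = α
... | tri> _ _ _ = β

-- choice functions for L: f(α,β) = f({α,β}) ∈ {α,β}
record ChoiceFn : Set where
  field
    fn  : Sen → Sen → Sen
    sym : ∀ α β → fn α β ≡ fn β α
    sel : ∀ α β → (fn α β ≡ α) ⊎ (fn α β ≡ β)

fbar : (Sen → Sen → Sen) → SenS → Sen
fbar f (atom n)   = atom n
fbar f (neg φ)    = neg (fbar f φ)
fbar f (conj φ ψ) = conj (fbar f φ) (fbar f ψ)
fbar f (bar φ ψ)  = f (fbar f φ) (fbar f ψ)

SatS : Assignment → (Sen → Sen → Sen) → SenS → Set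
SatS M f φ = M ⊨ fbar f φ

InReg* : ChoiceFn → Set₁
InReg* f = Σ (Sen → Sen → Set) λ _<_ → Σ (TotalOrdering _<_) λ sto →
             Regular _<_ × (∀ α β → ChoiceFn.fn f α β ≡ minOf sto α β)

SchemeConj : SenS → SenS → SenS → SenS
SchemeConj φ ψ σ = iff (bar φ (conj ψ σ)) (conj (bar φ ψ) (bar φ σ))

SchemeDisj : SenS → SenS → SenS → SenS
SchemeDisj φ ψ σ = iff (bar φ (disj ψ σ)) (disj (bar φ ψ) (bar φ σ))

AllStructuresSatisfy : (Sen → Sen → Sen) → (SenS → SenS → SenS → SenS) → Set
AllStructuresSatisfy f S = ∀ (M : Assignment) (φ ψ σ : SenS) → SatS M f (S φ ψ σ)

TautologyX : (ChoiceFn → Set) → (SenS → SenS → SenS → SenS) → Set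
TautologyX X S = ∀ (f : ChoiceFn) → X f → AllStructuresSatisfy (ChoiceFn.fn f) S

{-# OPTIONS --safe #-}

-- In any total
-- ordering some atom b lies strictly between atoms a and c, so f = min_< picks
-- a from {b, a} and b from {b, c}.  The instance φ = b, ψ = a, σ = c of (*) then
-- forces f(b, a ∧ c) ↔ a ∧ b; whichever of b or a ∧ c the function picks, one
-- truth assignment falsifies this (b alone true, resp. all atoms but c true).
-- Dually, (**) forces f(b, a ∨ c) ↔ a ∨ b, falsified by a alone true, resp.
-- c alone true.

module Submission where

open import Defs
open import Data.Bool using (true; false; not; _∧_)
open import Data.Nat using (ℕ; _≟_)
open import Data.Product using (Σ; ∃; ∃-syntax; _×_; _,_)
open import Data.Sum using (_⊎_; inj₁; inj₂)
open import Function.Definitions using (Injective)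
open import Relation.Binary.Definitions using (tri<; tri≈; tri>)
open import Relation.Binary.PropositionalEquality
  using (_≡_; _≢_; refl; sym; trans; cong; cong₂; subst; module ≡-Reasoning)
open import Relation.Binary.Structures using (IsStrictTotalOrder)
open import Relation.Nullary using (¬_; does; contradiction)
open import Relation.Nullary.Decidable using (dec-true; dec-false)

open ≡-Reasoning

module _ {_<_ : Sen → Sen → Set} (sto : TotalOrdering _<_) where
  open IsStrictTotalOrder sto

  minOf-≡ˡ : ∀ {α β} → α < β → minOf sto α β ≡ α
  minOf-≡ˡ {α} {β} α<β with compare α β
  ... | tri< _ _ _  = refl
  ... | tri≈ _ _ _  = refl
  ... | tri> α≮β _ _ = contradiction α<β α≮β

  minOf-≡ʳ : ∀ {α β} → β < α → minOf sto α β ≡ β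
  minOf-≡ʳ {α} {β} β<α with compare α β
  ... | tri< _ _ β≮α = contradiction β<α β≮α
  ... | tri≈ _ _ β≮α = contradiction β<α β≮α
  ... | tri> _ _ _   = refl

  minOf-selective : ∀ α β → minOf sto α β ≡ α ⊎ minOf sto α β ≡ β
  minOf-selective α β with compare α β
  ... | tri< _ _ _ = inj₁ refl
  ... | tri≈ _ _ _ = inj₁ refl
  ... | tri> _ _ _ = inj₂ refl

module _ {A : Set} {_<_ : A → A → Set} (sto : IsStrictTotalOrder _≡_ _<_) where
  open IsStrictTotalOrder sto

  chain-of-three : (g : ℕ → A) → Injective _≡_ _≡_ g →
                   ∃[ a ] ∃[ b ] ∃[ c ] (g a < g b × g b < g c)
  chain-of-three g g-inj with compare (g 0) (g 1) | compare (g 1) (g 2) | compare (g 0) (g 2)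
  ... | tri≈ _ e _ | _          | _          = contradiction (g-inj e) λ ()
  ... | _          | tri≈ _ e _ | _          = contradiction (g-inj e) λ ()
  ... | _          | _          | tri≈ _ e _ = contradiction (g-inj e) λ ()
  ... | tri< p _ _ | tri< q _ _ | _          = 0 , 1 , 2 , p , q
  ... | tri< _ _ _ | tri> _ _ q | tri< r _ _ = 0 , 2 , 1 , r , q
  ... | tri< p _ _ | tri> _ _ _ | tri> _ _ r = 2 , 0 , 1 , r , p
  ... | tri> _ _ p | tri< _ _ _ | tri< r _ _ = 1 , 0 , 2 , p , r
  ... | tri> _ _ _ | tri< q _ _ | tri> _ _ r = 1 , 2 , 0 , q , r
  ... | tri> _ _ p | tri> _ _ q | _          = 2 , 1 , 0 , q , p

  <⇒≢ : ∀ {x y} → x < y → x ≢ y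
  <⇒≢ x<y refl = irrefl refl x<y

atom-injective : Injective _≡_ _≡_ Sen.atom
atom-injective refl = refl

embed : Sen → SenS
embed (atom n)   = atom n
embed (neg α)    = neg (embed α)
embed (conj α β) = conj (embed α) (embed β)

fbar-embed : ∀ f α → fbar f (embed α) ≡ α
fbar-embed f (atom n)   = refl
fbar-embed f (neg α)    = cong neg (fbar-embed f α)
fbar-embed f (conj α β) = cong₂ conj (fbar-embed f α) (fbar-embed f β)

fbar-cong : ∀ {f g} → (∀ α β → f α β ≡ g α β) → ∀ φ → fbar f φ ≡ fbar g φ
fbar-cong f≗g (atom n)   = refl
fbar-cong f≗g (neg φ)    = cong neg (fbar-cong f≗g φ)
fbar-cong f≗g (conj φ ψ) = cong₂ conj (fbar-cong f≗g φ) (fbar-cong f≗g ψ)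
fbar-cong {g = g} f≗g (bar φ ψ) =
  trans (f≗g _ _) (cong₂ g (fbar-cong f≗g φ) (fbar-cong f≗g ψ))

AllStructuresSatisfy-cong : ∀ {f g} → (∀ α β → f α β ≡ g α β) → ∀ S →
                            AllStructuresSatisfy f S → AllStructuresSatisfy g S
AllStructuresSatisfy-cong f≗g S sat M φ ψ σ =
  subst (M ⊨_) (fbar-cong f≗g (S φ ψ σ)) (sat M φ ψ σ)

biconditional⇒≡ : ∀ x y → not (x ∧ not y) ∧ not (y ∧ not x) ≡ true → x ≡ y
biconditional⇒≡ false false _ = refl
biconditional⇒≡ true  true  _ = refl

⊨-iff⇒≡ : ∀ M f φ ψ → SatS M f (iff φ ψ) → eval M (fbar f φ) ≡ eval M (fbar f ψ)
⊨-iff⇒≡ M f φ ψ = biconditional⇒≡ (eval M (fbar f φ)) (eval M (fbar f ψ))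

disjL : Sen → Sen → Sen
disjL α β = neg (conj (neg α) (neg β))

SchemeConj-on-Sen : ∀ f → AllStructuresSatisfy f SchemeConj → ∀ M α β γ →
                    eval M (f α (conj β γ)) ≡ eval M (conj (f α β) (f α γ))
SchemeConj-on-Sen f sat M α β γ =
  subst (λ (α , β , γ) → eval M (f α (conj β γ)) ≡ eval M (conj (f α β) (f α γ)))
        (cong₂ _,_ (fbar-embed f α) (cong₂ _,_ (fbar-embed f β) (fbar-embed f γ)))
        (⊨-iff⇒≡ M f (bar (embed α) (conj (embed β) (embed γ)))
                      (conj (bar (embed α) (embed β)) (bar (embed α) (embed γ)))
                      (sat M (embed α) (embed β) (embed γ)))

SchemeDisj-on-Sen : ∀ f → AllStructuresSatisfy f SchemeDisj → ∀ M α β γ →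
                    eval M (f α (disjL β γ)) ≡ eval M (disjL (f α β) (f α γ))
SchemeDisj-on-Sen f sat M α β γ =
  subst (λ (α , β , γ) → eval M (f α (disjL β γ)) ≡ eval M (disjL (f α β) (f α γ)))
        (cong₂ _,_ (fbar-embed f α) (cong₂ _,_ (fbar-embed f β) (fbar-embed f γ)))
        (⊨-iff⇒≡ M f (bar (embed α) (disj (embed β) (embed γ)))
                      (disj (bar (embed α) (embed β)) (bar (embed α) (embed γ)))
                      (sat M (embed α) (embed β) (embed γ)))

only : ℕ → Assignment
only n m = does (m ≟ n)

only-self : ∀ n → only n n ≡ true
only-self n = dec-true (n ≟ n) refl

only-other : ∀ {m n} → m ≢ n → only n m ≡ false
only-other {m} {n} m≢n = dec-false (m ≟ n) m≢n

record Between (f : Sen → Sen → Sen) (a b c : ℕ) : Set where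
  field
    a≢b     : a ≢ b
    a≢c     : a ≢ c
    b≢c     : b ≢ c
    picks-a : f (atom b) (atom a) ≡ atom a
    picks-b : f (atom b) (atom c) ≡ atom b

module _ {f : Sen → Sen → Sen} (selective : ∀ α β → f α β ≡ α ⊎ f α β ≡ β)
         {a b c : ℕ} (between : Between f a b c) where
  open Between between

  SchemeConj-at-between : AllStructuresSatisfy f SchemeConj → ∀ M →
                          eval M (f (atom b) (conj (atom a) (atom c))) ≡ M a ∧ M b
  SchemeConj-at-between sat M =
    trans (SchemeConj-on-Sen f sat M _ _ _) (cong₂ (λ α β → eval M (conj α β)) picks-a picks-b)

  SchemeDisj-at-between : AllStructuresSatisfy f SchemeDisj → ∀ M →
                          eval M (f (atom b) (disjL (atom a) (atom c))) ≡ not (not (M a) ∧ not (M b))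
  SchemeDisj-at-between sat M =
    trans (SchemeDisj-on-Sen f sat M _ _ _) (cong₂ (λ α β → eval M (disjL α β)) picks-a picks-b)

  between⇒¬SchemeConj : ¬ AllStructuresSatisfy f SchemeConj
  between⇒¬SchemeConj sat with selective (atom b) (conj (atom a) (atom c))
  ... | inj₁ picks-b = contradiction
    (begin
      true                                                ≡⟨ only-self b ⟨
      only b b                                            ≡⟨ cong (eval (only b)) picks-b ⟨
      eval (only b) (f (atom b) (conj (atom a) (atom c))) ≡⟨ SchemeConj-at-between sat (only b) ⟩
      only b a ∧ only b b                                 ≡⟨ cong (_∧ only b b) (only-other a≢b) ⟩
      false                                               ∎) λ ()
  ... | inj₂ picks-ac = contradiction
    (begin
      true                                                  ≡⟨ cong₂ _∧_ (cong not (only-other a≢c))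
                                                                         (cong not (only-other b≢c)) ⟨
      all-but-c a ∧ all-but-c b                             ≡⟨ SchemeConj-at-between sat all-but-c ⟨
      eval all-but-c (f (atom b) (conj (atom a) (atom c))) ≡⟨ cong (eval all-but-c) picks-ac ⟩
      all-but-c a ∧ all-but-c c                             ≡⟨ cong₂ _∧_ (cong not (only-other a≢c))
                                                                         (cong not (only-self c)) ⟩
      false                                                 ∎) λ ()
    where
    all-but-c : Assignment
    all-but-c m = not (only c m)

  between⇒¬SchemeDisj : ¬ AllStructuresSatisfy f SchemeDisj
  between⇒¬SchemeDisj sat with selective (atom b) (disjL (atom a) (atom c))
  ... | inj₁ picks-b = contradiction
    (begin
      false                                                ≡⟨ only-other (λ b≡a → a≢b (sym b≡a)) ⟨
      only a b                                             ≡⟨ cong (eval (only a)) picks-b ⟨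
      eval (only a) (f (atom b) (disjL (atom a) (atom c))) ≡⟨ SchemeDisj-at-between sat (only a) ⟩
      not (not (only a a) ∧ not (only a b))                ≡⟨ cong (λ x → not (not x ∧ not (only a b))) (only-self a) ⟩
      true                                                 ∎) λ ()
  ... | inj₂ picks-ac = contradiction
    (begin
      true                                                 ≡⟨ cong₂ (λ x y → not (not x ∧ not y))
                                                                    (only-other a≢c) (only-self c) ⟨
      not (not (only c a) ∧ not (only c c))                ≡⟨ cong (eval (only c)) picks-ac ⟨
      eval (only c) (f (atom b) (disjL (atom a) (atom c))) ≡⟨ SchemeDisj-at-between sat (only c) ⟩
      not (not (only c a) ∧ not (only c b))                ≡⟨ cong₂ (λ x y → not (not x ∧ not y))
                                                                    (only-other a≢c) (only-other b≢c) ⟩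
      false                                                ∎) λ ()

module _ {_<_ : Sen → Sen → Set} (sto : TotalOrdering _<_) where
  open IsStrictTotalOrder sto using () renaming (trans to <-trans)

  minOf-has-between : ∃[ a ] ∃[ b ] ∃[ c ] Between (minOf sto) a b c
  minOf-has-between with chain-of-three sto atom atom-injective
  ... | a , b , c , a<b , b<c = a , b , c , record
    { a≢b     = λ a≡b → <⇒≢ sto a<b (cong atom a≡b)
    ; a≢c     = λ a≡c → <⇒≢ sto (<-trans a<b b<c) (cong atom a≡c)
    ; b≢c     = λ b≡c → <⇒≢ sto b<c (cong atom b≡c)
    ; picks-a = minOf-≡ʳ sto a<b
    ; picks-b = minOf-≡ˡ sto b<c
    }

  ¬minOf-SchemeConj : ¬ AllStructuresSatisfy (minOf sto) SchemeConj
  ¬minOf-SchemeConj with minOf-has-between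
  ... | _ , _ , _ , between = between⇒¬SchemeConj (minOf-selective sto) between

  ¬minOf-SchemeDisj : ¬ AllStructuresSatisfy (minOf sto) SchemeDisj
  ¬minOf-SchemeDisj with minOf-has-between
  ... | _ , _ , _ , between = between⇒¬SchemeDisj (minOf-selective sto) between

¬Reg*-tautology : ∀ S → (∀ {_<_} (sto : TotalOrdering _<_) → ¬ AllStructuresSatisfy (minOf sto) S) →
                  ¬ Σ (ChoiceFn → Set) λ X → (∀ f → X f → InReg* f) × (∃ λ f → X f) × TautologyX X S
¬Reg*-tautology S ¬sat (X , X⊆Reg* , (f , f∈X) , taut) with X⊆Reg* f f∈X
... | _ , sto , _ , f≗minOf = ¬sat sto (AllStructuresSatisfy-cong f≗minOf S (taut f f∈X))

proposition2p39 :
    (¬ Σ (Sen → Sen → Set) λ _<_ → Σ (TotalOrdering _<_) λ sto →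
         Regular _<_ × AllStructuresSatisfy (minOf sto) SchemeConj)
    × (¬ Σ (ChoiceFn → Set) λ X →
         (∀ f → X f → InReg* f) × (∃ λ f → X f) × TautologyX X SchemeConj)
    × (¬ Σ (Sen → Sen → Set) λ _<_ → Σ (TotalOrdering _<_) λ sto →
         Regular _<_ × AllStructuresSatisfy (minOf sto) SchemeDisj)
    × (¬ Σ (ChoiceFn → Set) λ X →
         (∀ f → X f → InReg* f) × (∃ λ f → X f) × TautologyX X SchemeDisj)
proposition2p39 =
    (λ (_ , sto , _ , sat) → ¬minOf-SchemeConj sto sat)
  , ¬Reg*-tautology SchemeConj ¬minOf-SchemeConj
  , (λ (_ , sto , _ , sat) → ¬minOf-SchemeDisj sto sat)
  , ¬Reg*-tautology SchemeDisj ¬minOf-SchemeDisj
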